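{- If $\Gamma \models \mathbb{M}:\tau$ and $\mathbb{M} \longrightarrow \mathbb{M}'$ then $\Gamma \models \mathbb{M}' :\tau$.
   Context: $\lambda^{\text{↯}}_{\oplus}$: resource $\lambda$-calculus with terms $M ::= x \mid \lambda x.M \mid M\,B \mid M\langle B/x\rangle \mid \mathtt{fail}^{\widetilde{x}}$, bags (multisets of terms), expressions = sums. Reduction: $\beta$ to explicit substitution; fetch (if $\mathrm{head}(M)=x$ and $\#(x,M)=|B|=k\ge1$, $M\langle B/x\rangle$ reduces to the sum of linear head substitutions of each $N_i\in B$ with the rest of the bag kept in the substitution); fail (if $\#(x,M)\ne|B|$, $M\langle B/x\rangle\longrightarrow\sum_{\mathrm{PER}(B)}\mathtt{fail}^{\widetilde{y}}$ collecting free variables); consumption rules $\mathtt{fail}^{\widetilde{x}}B\longrightarrow\sum\mathtt{fail}^{\widetilde{x}\uplus\mathrm{mfv}(B)}$ and $\mathtt{fail}^{\widetilde{x}}\langle B/z\rangle\longrightarrow\sum\mathtt{fail}^{(\widetilde{x}\setminus z)\uplus\mathrm{mfv}(B)}$ (when $\#(z,\widetilde{x})+|B|\ne0$); closure under term and sum contexts. $\models$ is well-formedness: well-typed expressions (non-idempotent intersection types, exact resource matching) are well-formed; well-formedness allows mismatches between bag sizes and expected multiplicities in application and explicit substitution, and types $\mathtt{fail}^{\widetilde{x}}$ with any $\tau$ when $\mathrm{dom}(\Gamma)=\widetilde{x}$. -}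

module Defs where

open import Data.Nat using (ℕ; zero; suc; _+_; _∸_; _!)
open import Data.Fin using (Fin; zero; suc; _≟_)
open import Data.List using (List; []; _∷_; _++_; length; replicate)
open import Data.List.NonEmpty using (List⁺; _∷_; _⁺++_; _∷⁺_) renaming (map to map⁺)
open import Data.List.Relation.Unary.All using (All)
open import Data.List.Relation.Binary.Permutation.Propositional using (_↭_)
open import Data.List.Relation.Binary.Pointwise using (Pointwise)
import Data.Vec.Relation.Binary.Pointwise.Inductive as VecPW
open import Data.Vec using (Vec; lookup; zipWith; _[_]≔_) renaming (replicate to vreplicate; _∷_ to _∷ᵥ_)
open import Data.Maybe using (Maybe; just; nothing)
open import Data.Product using (Σ; _×_; _,_; proj₁; proj₂)
open import Relation.Nullary using (yes; no)
open import Relation.Binary.PropositionalEquality using (_≡_; _≢_)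

-- Syntax.  Term n : terms whose free variables are among 0 … n-1
-- (de Bruijn indices).  λ and explicit substitution bind index 0.

infixl 7 _·_
infixl 8 _⟨_⟩

data Term (n : ℕ) : Set where
  var  : Fin n → Term n
  lam  : Term (suc n) → Term n
  _·_  : Term n → List (Term n) → Term n
  _⟨_⟩ : Term (suc n) → List (Term n) → Term n
  fail : List (Fin n) → Term n                -- fail^{x̃}  (x̃ a multiset of variables)

-- Bags: multisets of terms, represented by lists (1 = [], M·B = M ∷ B).
Bag : ℕ → Set
Bag n = List (Term n)

-- Expressions: non-empty formal sums of terms, represented by non-empty lists.
Expr : ℕ → Set
Expr n = List⁺ (Term n)

dropZero : ∀ {n} → List (Fin (suc n)) → List (Fin n)
dropZero []            = []
dropZero (zero  ∷ xs)  = dropZero xs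
dropZero (suc i ∷ xs)  = i ∷ dropZero xs

occ : ∀ {n} → Fin n → List (Fin n) → ℕ
occ i [] = 0
occ i (j ∷ xs) with i ≟ j
... | yes _ = suc (occ i xs)
... | no  _ = occ i xs

mutual
  mfv : ∀ {n} → Term n → List (Fin n)
  mfv (var x)    = x ∷ []
  mfv (lam M)    = dropZero (mfv M)
  mfv (M · B)    = mfv M ++ mfvB B
  mfv (M ⟨ B ⟩)  = dropZero (mfv M) ++ mfvB B
  mfv (fail xs)  = xs

  mfvB : ∀ {n} → Bag n → List (Fin n)
  mfvB []       = []
  mfvB (M ∷ B)  = mfv M ++ mfvB B

#[_,_] : ∀ {n} → Fin n → Term n → ℕ
#[ x , M ] = occ x (mfv M)

headVar : ∀ {n} → Term n → Maybe (Fin n)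
headVar (var x)   = just x
headVar (lam M)   = nothing
headVar (M · B)   = headVar M
headVar (M ⟨ B ⟩) with headVar M
... | just (suc i) = just i
... | _            = nothing
headVar (fail xs) = nothing

ext : ∀ {n m} → (Fin n → Fin m) → Fin (suc n) → Fin (suc m)
ext ρ zero    = zero
ext ρ (suc i) = suc (ρ i)

mapFin : ∀ {n m} → (Fin n → Fin m) → List (Fin n) → List (Fin m)
mapFin ρ []       = []
mapFin ρ (x ∷ xs) = ρ x ∷ mapFin ρ xs

mutual
  rename : ∀ {n m} → (Fin n → Fin m) → Term n → Term m
  rename ρ (var x)   = var (ρ x)
  rename ρ (lam M)   = lam (rename (ext ρ) M)
  rename ρ (M · B)   = rename ρ M · renameB ρ B
  rename ρ (M ⟨ B ⟩) = rename (ext ρ) M ⟨ renameB ρ B ⟩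
  rename ρ (fail xs) = fail (mapFin ρ xs)

  renameB : ∀ {n m} → (Fin n → Fin m) → Bag n → Bag m
  renameB ρ []      = []
  renameB ρ (M ∷ B) = rename ρ M ∷ renameB ρ B

weaken : ∀ {n} → Term n → Term (suc n)
weaken = rename suc

-- linear head substitution M{| N / x |}: replaces the head occurrence of x
-- (only used when headVar M ≡ just x)
headSubst : ∀ {n} → Term n → Fin n → Term n → Term n
headSubst (var y)   x N with y ≟ x
... | yes _ = N
... | no  _ = var y
headSubst (lam M)   x N = lam M
headSubst (M · B)   x N = headSubst M x N · B
headSubst (M ⟨ B ⟩) x N = headSubst M (suc x) (weaken N) ⟨ B ⟩
headSubst (fail xs) x N = fail xs

picks : ∀ {A : Set} → List A → List (A × List A)
picks []       = []
picks (x ∷ xs) = (x , xs) ∷ Data.List.map (λ p → (proj₁ p , x ∷ proj₂ p)) (picks xs)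
  where import Data.List

picks⁺ : ∀ {A : Set} → A → List A → List⁺ (A × List A)
picks⁺ x xs = (x , xs) ∷ Data.List.map (λ p → (proj₁ p , x ∷ proj₂ p)) (picks xs)
  where import Data.List

-- Σ_{PER(B)} t : one summand per permutation of B, i.e. |B|! copies of t
sumPER : ∀ {n} → Bag n → Term n → Expr n
sumPER B t = t ∷ replicate ((length B) ! ∸ 1) t

infix 4 _⟶ₜ_ _⟶_

data _⟶ₜ_ {n : ℕ} : Term n → Expr n → Set where
  R-Beta  : ∀ {M B} → lam M · B ⟶ₜ (M ⟨ B ⟩ ∷ [])
  R-Fetch : ∀ {M N B} → headVar M ≡ just zero → #[ zero , M ] ≡ length (N ∷ B) →
            M ⟨ N ∷ B ⟩ ⟶ₜ map⁺ (λ p → headSubst M zero (weaken (proj₁ p)) ⟨ proj₂ p ⟩) (picks⁺ N B)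
  R-Fail  : ∀ {M B} → #[ zero , M ] ≢ length B →
            M ⟨ B ⟩ ⟶ₜ sumPER B (fail (dropZero (mfv M) ++ mfvB B))
  R-Cons₁ : ∀ {xs B} → fail xs · B ⟶ₜ sumPER B (fail (xs ++ mfvB B))
  R-Cons₂ : ∀ {xs B} → occ zero xs + length B ≢ 0 →
            fail xs ⟨ B ⟩ ⟶ₜ sumPER B (fail (dropZero xs ++ mfvB B))
  R-TCont-app : ∀ {M 𝕄 B} → M ⟶ₜ 𝕄 → M · B ⟶ₜ map⁺ (λ M' → M' · B) 𝕄
  R-TCont-es  : ∀ {M 𝕄 B} → M ⟶ₜ 𝕄 → M ⟨ B ⟩ ⟶ₜ map⁺ (λ M' → M' ⟨ B ⟩) 𝕄

data _⟶_ {n : ℕ} : Expr n → Expr n → Set where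
  R-here  : ∀ {M 𝕄 R} → M ⟶ₜ 𝕄 → (M ∷ R) ⟶ (𝕄 ⁺++ R)
  R-there : ∀ {M M' R 𝕄'} → (M' ∷ R) ⟶ 𝕄' → (M ∷ M' ∷ R) ⟶ (M ∷⁺ 𝕄')

-- Types.  Strict types σ ::= unit | π → σ ;  multiset types π ::= ∧σᵢ | ω
-- (multisets represented by lists, ω = []).  σ^k = replicate k σ.

data SType : Set where
  unit : SType
  _⇒_  : List SType → SType → SType

MType : Set
MType = List SType

_^_ : SType → ℕ → MType
σ ^ k = replicate k σ

-- equality of types up to commutativity/associativity of ∧ (types are
-- formally multisets; lists are only representatives)
data _≃_ : SType → SType → Set where
  unit : unit ≃ unit
  arr  : ∀ {π ρ π' σ σ'} → π ↭ ρ → Pointwise _≃_ ρ π' → σ ≃ σ' → (π ⇒ σ) ≃ (π' ⇒ σ')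

_≃ₘ_ : MType → MType → Set
π ≃ₘ π' = Σ MType (λ ρ → (π ↭ ρ) × Pointwise _≃_ ρ π')

-- Typing contexts: every variable 0 … n-1 gets a multiset type (ω = absent)
Ctx : ℕ → Set
Ctx n = Vec MType n

∅ : ∀ {n} → Ctx n
∅ = vreplicate _ []

[_∶_] : ∀ {n} → Fin n → SType → Ctx n
[ x ∶ σ ] = ∅ [ x ]≔ (σ ∷ [])

_∧_ : ∀ {n} → Ctx n → Ctx n → Ctx n
_∧_ = zipWith _++_

_≈_ : ∀ {n} → Ctx n → Ctx n → Set
_≈_ = VecPW.Pointwise _≃ₘ_

dom_≡_ : ∀ {n} → Ctx n → List (Fin n) → Set
dom Γ ≡ xs = ∀ i → length (lookup Γ i) ≡ occ i xs

-- Intersection type system  ⊢  (exact resource matching)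

infix 3 _⊢_∶_ _⊢ᵇ_∶_ _⊨_∶_ _⊨ᵇ_∶_ _⊨ₑ_∶_

mutual
  data _⊢_∶_ {n : ℕ} : Ctx n → Term n → SType → Set where
    T-var  : ∀ {x σ} → [ x ∶ σ ] ⊢ var x ∶ σ
    T-abs  : ∀ {Γ M σ k τ} → (σ ^ k) ∷ᵥ Γ ⊢ M ∶ τ → Γ ⊢ lam M ∶ (σ ^ k) ⇒ τ
    T-app  : ∀ {Γ Δ M B σ k τ} → Γ ⊢ M ∶ (σ ^ k) ⇒ τ → Δ ⊢ᵇ B ∶ σ ^ k → Γ ∧ Δ ⊢ M · B ∶ τ
    T-ex   : ∀ {Γ Δ M B σ k τ} → (σ ^ k) ∷ᵥ Γ ⊢ M ∶ τ → Δ ⊢ᵇ B ∶ σ ^ k → Γ ∧ Δ ⊢ M ⟨ B ⟩ ∶ τ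
    T-conv : ∀ {Γ Γ' M σ σ'} → Γ ≈ Γ' → σ ≃ σ' → Γ ⊢ M ∶ σ → Γ' ⊢ M ∶ σ'

  data _⊢ᵇ_∶_ {n : ℕ} : Ctx n → Bag n → MType → Set where
    T-one   : ∅ ⊢ᵇ [] ∶ []
    T-bag   : ∀ {Γ Δ M B σ k} → Γ ⊢ M ∶ σ → Δ ⊢ᵇ B ∶ σ ^ k → Γ ∧ Δ ⊢ᵇ M ∷ B ∶ σ ^ suc k
    T-convᵇ : ∀ {Γ Γ' B π π'} → Γ ≈ Γ' → π ≃ₘ π' → Γ ⊢ᵇ B ∶ π → Γ' ⊢ᵇ B ∶ π'

-- Well-formedness  ⊨  (mismatches of bag sizes allowed; fail typable)

mutual
  data _⊨_∶_ {n : ℕ} : Ctx n → Term n → SType → Set where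
    F-wf-expr : ∀ {Γ M σ} → Γ ⊢ M ∶ σ → Γ ⊨ M ∶ σ
    F-abs     : ∀ {Γ M σ k τ} → (σ ^ k) ∷ᵥ Γ ⊨ M ∶ τ → Γ ⊨ lam M ∶ (σ ^ k) ⇒ τ
    F-app     : ∀ {Γ Δ M B σ j k τ} → Γ ⊨ M ∶ (σ ^ j) ⇒ τ → Δ ⊨ᵇ B ∶ σ ^ k → Γ ∧ Δ ⊨ M · B ∶ τ
    F-ex-sub  : ∀ {Γ Δ M B σ j k τ} → (σ ^ j) ∷ᵥ Γ ⊨ M ∶ τ → Δ ⊨ᵇ B ∶ σ ^ k → Γ ∧ Δ ⊨ M ⟨ B ⟩ ∶ τ
    F-fail    : ∀ {Γ xs τ} → dom Γ ≡ xs → Γ ⊨ fail xs ∶ τ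
    F-conv    : ∀ {Γ Γ' M σ σ'} → Γ ≈ Γ' → σ ≃ σ' → Γ ⊨ M ∶ σ → Γ' ⊨ M ∶ σ'

  data _⊨ᵇ_∶_ {n : ℕ} : Ctx n → Bag n → MType → Set where
    F-wf-bag : ∀ {Γ B π} → Γ ⊢ᵇ B ∶ π → Γ ⊨ᵇ B ∶ π
    F-bag    : ∀ {Γ Δ M B σ k} → Γ ⊨ M ∶ σ → Δ ⊨ᵇ B ∶ σ ^ k → Γ ∧ Δ ⊨ᵇ M ∷ B ∶ σ ^ suc k
    F-convᵇ  : ∀ {Γ Γ' B π π'} → Γ ≈ Γ' → π ≃ₘ π' → Γ ⊨ᵇ B ∶ π → Γ' ⊨ᵇ B ∶ π'

_⊨ₑ_∶_ : ∀ {n} → Ctx n → Expr n → SType → Set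
Γ ⊨ₑ (M ∷ R) ∶ σ = (Γ ⊨ M ∶ σ) × All (λ N → Γ ⊨ N ∶ σ) R

-- Every ⊨-derivation ends with a syntax-directed rule followed by conversions, which gives
-- generation lemmas.  Well-formedness is relevant: the domain of Γ is exactly the multiset of
-- free variables of the term.  Since a failure reduct fail^x̃ collects exactly the free
-- variables of its redex, it is well-formed in the redex's context.  A β-step turns the
-- premises of the abstraction into those of an explicit substitution.  For fetch, the head
-- occurrence of x is a hole of type σ whose context holds one copy of x : σ; after permuting
-- the bag, any of its elements can be plugged into that hole.  The remaining bag and the
-- remaining copies of x need not agree in number, because ⊨ tolerates such mismatches.

module Submission where

open import Defs
open import Data.Nat using (ℕ; zero; suc; _+_)
open import Data.Fin using (Fin; zero; suc; _≟_; punchIn; punchOut)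
open import Data.Fin.Properties using (punchIn-injective; punchInᵢ≢i; punchIn-punchOut)
open import Data.List using (List; []; _∷_; _++_; length)
import Data.List.Properties as List
open import Data.List.NonEmpty using (_∷_; toList)
open import Data.List.Relation.Unary.All using (All; []; _∷_)
import Data.List.Relation.Unary.All as All
import Data.List.Relation.Unary.All.Properties as All
open import Data.List.Relation.Binary.Pointwise using (Pointwise; []; _∷_)
import Data.List.Relation.Binary.Pointwise as Pointwise
open import Data.List.Relation.Binary.Permutation.Propositional using (_↭_; ↭-sym)
import Data.List.Relation.Binary.Permutation.Propositional as ↭
import Data.List.Relation.Binary.Permutation.Propositional.Properties as ↭
open import Data.Vec using (lookup; insertAt) renaming (_∷_ to _∷ᵥ_)
open import Data.Vec.Properties
  using (lookup-zipWith; lookup-replicate; lookup∘update; lookup∘update′;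
         insertAt-lookup; insertAt-punchIn)
open import Data.Vec.Relation.Binary.Pointwise.Inductive using ([]; _∷_)
import Data.Vec.Relation.Binary.Pointwise.Inductive as VecPointwise
open import Data.Maybe using (just)
open import Data.Product using (_×_; _,_; proj₁; proj₂; ∃-syntax)
open import Data.Empty using (⊥-elim)
open import Function using (id)
open import Relation.Nullary using (yes; no)
open import Relation.Binary.Bundles using (Setoid)
open import Relation.Binary.PropositionalEquality
  using (_≡_; _≢_; _≗_; refl; sym; trans; cong; cong₂; subst; module ≡-Reasoning)

private variable
  A C : Set
  n : ℕ
  j k : ℕ
  σ σ' σ'' τ τ' : SType
  π π' π'' : MType
  _∼_ : A → C → Set
  as : List A
  bs cs : List C

Pointwise-↭ʳ : Pointwise _∼_ as bs → bs ↭ cs →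
               ∃[ ds ] as ↭ ds × Pointwise _∼_ ds cs
Pointwise-↭ʳ rs ↭.refl = _ , ↭.refl , rs
Pointwise-↭ʳ (r ∷ rs) (↭.prep _ p) =
  let _ , p′ , rs′ = Pointwise-↭ʳ rs p in _ , ↭.prep _ p′ , r ∷ rs′
Pointwise-↭ʳ (r ∷ s ∷ rs) (↭.swap _ _ p) =
  let _ , p′ , rs′ = Pointwise-↭ʳ rs p in _ , ↭.swap _ _ p′ , s ∷ r ∷ rs′
Pointwise-↭ʳ rs (↭.trans p q) =
  let _ , p′ , rs′ = Pointwise-↭ʳ rs p
      _ , q′ , rs″ = Pointwise-↭ʳ rs′ q
  in _ , ↭.trans p′ q′ , rs″

Pointwise-↭ˡ : Pointwise _∼_ as bs → as ↭ cs →
               ∃[ ds ] bs ↭ ds × Pointwise _∼_ cs ds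
Pointwise-↭ˡ {_∼_ = _∼_} rs p =
  let ds , p′ , rs′ = Pointwise-↭ʳ {_∼_ = λ c a → a ∼ c} (Pointwise.symmetric id rs) p
  in ds , p′ , Pointwise.symmetric id rs′

mutual
  ≃-refl : σ ≃ σ
  ≃-refl {unit}  = unit
  ≃-refl {π ⇒ σ} = arr ↭.refl ≃ₚ-refl ≃-refl

  ≃ₚ-refl : Pointwise _≃_ π π
  ≃ₚ-refl {[]}    = []
  ≃ₚ-refl {σ ∷ π} = ≃-refl ∷ ≃ₚ-refl

mutual
  ≃-sym : σ ≃ σ' → σ' ≃ σ
  ≃-sym unit         = unit
  ≃-sym (arr p q r) =
    let _ , p′ , q′ = Pointwise-↭ʳ (≃ₚ-sym q) (↭-sym p) in arr p′ q′ (≃-sym r)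

  ≃ₚ-sym : Pointwise _≃_ π π' → Pointwise _≃_ π' π
  ≃ₚ-sym []       = []
  ≃ₚ-sym (r ∷ rs) = ≃-sym r ∷ ≃ₚ-sym rs

-- q₁ must stay the first argument of the recursive call to ≃ₚ-trans, so the permutation p₂
-- is pushed through q₂ rather than through q₁.
mutual
  ≃-trans : σ ≃ σ' → σ' ≃ σ'' → σ ≃ σ''
  ≃-trans unit unit = unit
  ≃-trans (arr p₁ q₁ r₁) (arr p₂ q₂ r₂) =
    let _ , p₃ , q₃ = Pointwise-↭ˡ q₂ (↭-sym p₂)
        _ , p₄ , q₄ = Pointwise-↭ʳ (≃ₚ-trans q₁ q₃) (↭-sym p₃)
    in arr (↭.trans p₁ p₄) q₄ (≃-trans r₁ r₂)

  ≃ₚ-trans : Pointwise _≃_ π π' → Pointwise _≃_ π' π'' → Pointwise _≃_ π π''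
  ≃ₚ-trans []       []       = []
  ≃ₚ-trans (r ∷ rs) (s ∷ ss) = ≃-trans r s ∷ ≃ₚ-trans rs ss

≃ₘ-refl : π ≃ₘ π
≃ₘ-refl = _ , ↭.refl , ≃ₚ-refl

≃ₘ-reflexive : π ≡ π' → π ≃ₘ π'
≃ₘ-reflexive refl = ≃ₘ-refl

↭⇒≃ₘ : π ↭ π' → π ≃ₘ π'
↭⇒≃ₘ p = _ , p , ≃ₚ-refl

≃ₘ-sym : π ≃ₘ π' → π' ≃ₘ π
≃ₘ-sym (_ , p , q) = Pointwise-↭ʳ (≃ₚ-sym q) (↭-sym p)

≃ₘ-trans : π ≃ₘ π' → π' ≃ₘ π'' → π ≃ₘ π''
≃ₘ-trans (_ , p₁ , q₁) (_ , p₂ , q₂) =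
  let _ , p , q = Pointwise-↭ʳ q₁ p₂ in _ , ↭.trans p₁ p , ≃ₚ-trans q q₂

≃ₘ-++ : ∀ {π₁ π₁' π₂ π₂'} → π₁ ≃ₘ π₁' → π₂ ≃ₘ π₂' → (π₁ ++ π₂) ≃ₘ (π₁' ++ π₂')
≃ₘ-++ (_ , p , q) (_ , p′ , q′) = _ , ↭.++⁺ p p′ , Pointwise.++⁺ q q′

≃ₘ-length : π ≃ₘ π' → length π ≡ length π'
≃ₘ-length (_ , p , q) = trans (↭.↭-length p) (Pointwise.Pointwise-length q)

^-uniform : ∀ k → All (_≃ σ) (σ ^ k)
^-uniform k = All.replicate⁺ k ≃-refl

uniform-≃ₘ : All (_≃ σ) π' → π ≃ₘ π' → All (_≃ σ) π
uniform-≃ₘ al (_ , p , q) =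
  ↭.All-resp-↭ (↭-sym p) (Pointwise.All-resp-Pointwise ≃-trans (Pointwise.symmetric id q) al)

uniform⇒≃ₘ^ : All (_≃ σ) π → π ≃ₘ (σ ^ length π)
uniform⇒≃ₘ^ al = _ , ↭.refl , pointwise al
  where
  pointwise : ∀ {π} → All (_≃ σ) π → Pointwise _≃_ π (σ ^ length π)
  pointwise []       = []
  pointwise (r ∷ al) = r ∷ pointwise al

private variable
  Γ Γ' Γ'' Δ Δ' Θ : Ctx n

≈-refl : Γ ≈ Γ
≈-refl = VecPointwise.refl ≃ₘ-refl

≈-reflexive : Γ ≡ Γ' → Γ ≈ Γ'
≈-reflexive refl = ≈-refl

≈-sym : Γ ≈ Γ' → Γ' ≈ Γ
≈-sym = VecPointwise.sym ≃ₘ-sym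

≈-trans : Γ ≈ Γ' → Γ' ≈ Γ'' → Γ ≈ Γ''
≈-trans = VecPointwise.trans ≃ₘ-trans

≈-setoid : ℕ → Setoid _ _
≈-setoid n = record
  { Carrier       = Ctx n
  ; _≈_           = _≈_
  ; isEquivalence = record { refl = ≈-refl ; sym = ≈-sym ; trans = ≈-trans }
  }

∧-cong : Γ ≈ Γ' → Δ ≈ Δ' → (Γ ∧ Δ) ≈ (Γ' ∧ Δ')
∧-cong = VecPointwise.zipWith-cong ≃ₘ-++

∧-comm : ∀ (Γ Δ : Ctx n) → (Γ ∧ Δ) ≈ (Δ ∧ Γ)
∧-comm = VecPointwise.zipWith-comm (λ π π' → ↭⇒≃ₘ (↭.++-comm π π'))

∧-assoc : ∀ (Γ Δ Θ : Ctx n) → ((Γ ∧ Δ) ∧ Θ) ≈ (Γ ∧ (Δ ∧ Θ))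
∧-assoc = VecPointwise.zipWith-assoc (λ π π' π'' → ≃ₘ-reflexive (List.++-assoc π π' π''))

∧-identityˡ : ∀ (Γ : Ctx n) → (∅ ∧ Γ) ≈ Γ
∧-identityˡ = VecPointwise.zipWith-identityˡ (λ _ → ≃ₘ-refl)

∧-identityʳ : ∀ (Γ : Ctx n) → (Γ ∧ ∅) ≈ Γ
∧-identityʳ = VecPointwise.zipWith-identityʳ (λ π → ≃ₘ-reflexive (List.++-identityʳ π))

∧-swapʳ : ∀ (Γ Δ Θ : Ctx n) → ((Γ ∧ Δ) ∧ Θ) ≈ ((Γ ∧ Θ) ∧ Δ)
∧-swapʳ Γ Δ Θ = ≈-trans (∧-assoc Γ Δ Θ)
  (≈-trans (∧-cong (≈-refl {Γ = Γ}) (∧-comm Δ Θ)) (≈-sym (∧-assoc Γ Θ Δ)))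

∧-swapˡ : ∀ (Γ Δ Θ : Ctx n) → (Γ ∧ (Δ ∧ Θ)) ≈ (Δ ∧ (Γ ∧ Θ))
∧-swapˡ Γ Δ Θ = ≈-trans (≈-sym (∧-assoc Γ Δ Θ))
  (≈-trans (∧-cong (∧-comm Γ Δ) (≈-refl {Γ = Θ})) (∧-assoc Δ Γ Θ))

occ-hit : ∀ (i : Fin n) xs → occ i (i ∷ xs) ≡ suc (occ i xs)
occ-hit i xs with i ≟ i
... | yes _  = refl
... | no i≢i = ⊥-elim (i≢i refl)

occ-miss : ∀ {i j : Fin n} xs → i ≢ j → occ i (j ∷ xs) ≡ occ i xs
occ-miss {i = i} {j} xs i≢j with i ≟ j
... | yes i≡j = ⊥-elim (i≢j i≡j)
... | no _    = refl

occ-++ : ∀ (i : Fin n) xs ys → occ i (xs ++ ys) ≡ occ i xs + occ i ys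
occ-++ i []       ys = refl
occ-++ i (j ∷ xs) ys with i ≟ j
... | yes _ = cong suc (occ-++ i xs ys)
... | no _  = occ-++ i xs ys

occ-dropZero : ∀ (i : Fin n) xs → occ i (dropZero xs) ≡ occ (suc i) xs
occ-dropZero i []           = refl
occ-dropZero i (zero ∷ xs)  = occ-dropZero i xs
occ-dropZero i (suc j ∷ xs) with i ≟ j
... | yes refl = cong suc (occ-dropZero i xs)
... | no i≢j   = occ-dropZero i xs

occ-mapFin-injective : ∀ {m} {ρ : Fin n → Fin m} → (∀ {i j} → ρ i ≡ ρ j → i ≡ j) →
                       ∀ i xs → occ (ρ i) (mapFin ρ xs) ≡ occ i xs
occ-mapFin-injective ρ-inj i []       = refl
occ-mapFin-injective {ρ = ρ} ρ-inj i (j ∷ xs) with i ≟ j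
... | yes refl = trans (occ-hit (ρ i) _) (cong suc (occ-mapFin-injective ρ-inj i xs))
... | no i≢j   = trans (occ-miss _ (λ e → i≢j (ρ-inj e))) (occ-mapFin-injective ρ-inj i xs)

occ-mapFin-∉ : ∀ {m} (ρ : Fin n → Fin m) {j} → (∀ i → ρ i ≢ j) → ∀ xs → occ j (mapFin ρ xs) ≡ 0
occ-mapFin-∉ ρ j∉ρ []       = refl
occ-mapFin-∉ ρ j∉ρ (x ∷ xs) = trans (occ-miss _ (λ e → j∉ρ x (sym e))) (occ-mapFin-∉ ρ j∉ρ xs)

mapFin-cong : ∀ {m} {ρ ρ' : Fin n → Fin m} → ρ ≗ ρ' → ∀ xs → mapFin ρ xs ≡ mapFin ρ' xs
mapFin-cong ρ≗ρ' []       = refl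
mapFin-cong ρ≗ρ' (x ∷ xs) = cong₂ _∷_ (ρ≗ρ' x) (mapFin-cong ρ≗ρ' xs)

dom-≈ : ∀ xs → Γ ≈ Γ' → dom Γ ≡ xs → dom Γ' ≡ xs
dom-≈ xs Γ≈Γ' dom-Γ i = trans (sym (≃ₘ-length (VecPointwise.lookup Γ≈Γ' i))) (dom-Γ i)

dom-∧ : ∀ (Γ Δ : Ctx n) xs ys → dom Γ ≡ xs → dom Δ ≡ ys → dom (Γ ∧ Δ) ≡ (xs ++ ys)
dom-∧ Γ Δ xs ys dom-Γ dom-Δ i = begin
  length (lookup (Γ ∧ Δ) i)                  ≡⟨ cong length (lookup-zipWith _++_ i Γ Δ) ⟩
  length (lookup Γ i ++ lookup Δ i)          ≡⟨ List.length-++ (lookup Γ i) ⟩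
  length (lookup Γ i) + length (lookup Δ i)  ≡⟨ cong₂ _+_ (dom-Γ i) (dom-Δ i) ⟩
  occ i xs + occ i ys                        ≡⟨ sym (occ-++ i xs ys) ⟩
  occ i (xs ++ ys)                           ∎
  where open ≡-Reasoning

dom-∅ : dom (∅ {n}) ≡ []
dom-∅ i = cong length (lookup-replicate i [])

dom-single : ∀ (x : Fin n) σ → dom [ x ∶ σ ] ≡ (x ∷ [])
dom-single x σ i with i ≟ x
... | yes refl = cong length (lookup∘update i ∅ (σ ∷ []))
... | no i≢x   = cong length (trans (lookup∘update′ i≢x ∅ (σ ∷ [])) (lookup-replicate i []))

dom-tail : ∀ {Γ : Ctx n} {π} xs → dom (π ∷ᵥ Γ) ≡ xs → dom Γ ≡ dropZero xs
dom-tail xs dom-πΓ i = trans (dom-πΓ (suc i)) (sym (occ-dropZero i xs))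

data UpTo {A : Set} (_∼_ : A → A → Set) (P : Ctx n → A → Set) (Γ : Ctx n) (a : A) : Set where
  conv : ∀ {Γ' a'} → P Γ' a' → Γ' ≈ Γ → a' ∼ a → UpTo _∼_ P Γ a

Gen : (Ctx n → SType → Set) → Ctx n → SType → Set
Gen = UpTo _≃_

Genᵇ : (Ctx n → MType → Set) → Ctx n → MType → Set
Genᵇ = UpTo _≃ₘ_

private variable
  P : Ctx n → SType → Set
  Q : Ctx n → MType → Set

gen-base : P Γ τ → Gen P Γ τ
gen-base p = conv p ≈-refl ≃-refl

gen-conv : Γ ≈ Γ' → τ ≃ τ' → Gen P Γ τ → Gen P Γ' τ'
gen-conv e c (conv p e′ c′) = conv p (≈-trans e′ e) (≃-trans c′ c)

genᵇ-base : Q Γ π → Genᵇ Q Γ π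
genᵇ-base q = conv q ≈-refl ≃ₘ-refl

genᵇ-conv : Γ ≈ Γ' → π ≃ₘ π' → Genᵇ Q Γ π → Genᵇ Q Γ' π'
genᵇ-conv e c (conv q e′ c′) = conv q (≈-trans e′ e) (≃ₘ-trans c′ c)

data Var⊨ (x : Fin n) : Ctx n → SType → Set where
  var : Var⊨ x [ x ∶ σ ] σ

data Abs⊨ (M : Term (suc n)) : Ctx n → SType → Set where
  abs : (σ ^ k) ∷ᵥ Γ ⊨ M ∶ τ → Abs⊨ M Γ ((σ ^ k) ⇒ τ)

data App⊨ (M : Term n) (B : Bag n) : Ctx n → SType → Set where
  app : Γ ⊨ M ∶ (σ ^ j) ⇒ τ → Δ ⊨ᵇ B ∶ σ ^ k → App⊨ M B (Γ ∧ Δ) τ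

data Ex⊨ (M : Term (suc n)) (B : Bag n) : Ctx n → SType → Set where
  ex : (σ ^ j) ∷ᵥ Γ ⊨ M ∶ τ → Δ ⊨ᵇ B ∶ σ ^ k → Ex⊨ M B (Γ ∧ Δ) τ

data Nil⊨ {n : ℕ} : Ctx n → MType → Set where
  nil : Nil⊨ ∅ []

data Cons⊨ (M : Term n) (B : Bag n) : Ctx n → MType → Set where
  cons : Γ ⊨ M ∶ σ → Δ ⊨ᵇ B ∶ σ ^ k → Cons⊨ M B (Γ ∧ Δ) (σ ^ suc k)

private variable
  x : Fin n
  xs : List (Fin n)
  M N : Term n
  B R : Bag n

genᵀ-var : Γ ⊢ var x ∶ τ → Gen (Var⊨ x) Γ τ
genᵀ-var T-var          = gen-base var
genᵀ-var (T-conv e c d) = gen-conv e c (genᵀ-var d)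

gen-var : Γ ⊨ var x ∶ τ → Gen (Var⊨ x) Γ τ
gen-var (F-wf-expr d)  = genᵀ-var d
gen-var (F-conv e c d) = gen-conv e c (gen-var d)

genᵀ-lam : {M : Term (suc n)} → Γ ⊢ lam M ∶ τ → Gen (Abs⊨ M) Γ τ
genᵀ-lam (T-abs d)      = gen-base (abs (F-wf-expr d))
genᵀ-lam (T-conv e c d) = gen-conv e c (genᵀ-lam d)

gen-lam : {M : Term (suc n)} → Γ ⊨ lam M ∶ τ → Gen (Abs⊨ M) Γ τ
gen-lam (F-wf-expr d)  = genᵀ-lam d
gen-lam (F-abs d)      = gen-base (abs d)
gen-lam (F-conv e c d) = gen-conv e c (gen-lam d)

genᵀ-app : Γ ⊢ M · B ∶ τ → Gen (App⊨ M B) Γ τ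
genᵀ-app (T-app d e)    = gen-base (app (F-wf-expr d) (F-wf-bag e))
genᵀ-app (T-conv e c d) = gen-conv e c (genᵀ-app d)

gen-app : Γ ⊨ M · B ∶ τ → Gen (App⊨ M B) Γ τ
gen-app (F-wf-expr d)  = genᵀ-app d
gen-app (F-app d e)    = gen-base (app d e)
gen-app (F-conv e c d) = gen-conv e c (gen-app d)

genᵀ-ex : {M : Term (suc n)} → Γ ⊢ M ⟨ B ⟩ ∶ τ → Gen (Ex⊨ M B) Γ τ
genᵀ-ex (T-ex d e)     = gen-base (ex (F-wf-expr d) (F-wf-bag e))
genᵀ-ex (T-conv e c d) = gen-conv e c (genᵀ-ex d)

gen-ex : {M : Term (suc n)} → Γ ⊨ M ⟨ B ⟩ ∶ τ → Gen (Ex⊨ M B) Γ τ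
gen-ex (F-wf-expr d)    = genᵀ-ex d
gen-ex (F-ex-sub d e)   = gen-base (ex d e)
gen-ex (F-conv e c d)   = gen-conv e c (gen-ex d)

-- No ⊢-rule types fail, so only conversions can occur.
genᵀ-fail : Γ ⊢ fail xs ∶ τ → dom Γ ≡ xs
genᵀ-fail {xs = xs} (T-conv e _ d) = dom-≈ xs e (genᵀ-fail d)

gen-fail : Γ ⊨ fail xs ∶ τ → dom Γ ≡ xs
gen-fail (F-wf-expr d)            = genᵀ-fail d
gen-fail (F-fail dom-Γ)           = dom-Γ
gen-fail {xs = xs} (F-conv e _ d) = dom-≈ xs e (gen-fail d)

genᵀ-nil : Δ ⊢ᵇ [] ∶ π → Genᵇ Nil⊨ Δ π
genᵀ-nil T-one             = genᵇ-base nil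
genᵀ-nil (T-convᵇ e c d)   = genᵇ-conv e c (genᵀ-nil d)

gen-nil : Δ ⊨ᵇ [] ∶ π → Genᵇ Nil⊨ Δ π
gen-nil (F-wf-bag d)     = genᵀ-nil d
gen-nil (F-convᵇ e c d)  = genᵇ-conv e c (gen-nil d)

genᵀ-cons : Δ ⊢ᵇ M ∷ B ∶ π → Genᵇ (Cons⊨ M B) Δ π
genᵀ-cons (T-bag d e)      = genᵇ-base (cons (F-wf-expr d) (F-wf-bag e))
genᵀ-cons (T-convᵇ e c d)  = genᵇ-conv e c (genᵀ-cons d)

gen-cons : Δ ⊨ᵇ M ∷ B ∶ π → Genᵇ (Cons⊨ M B) Δ π
gen-cons (F-wf-bag d)     = genᵀ-cons d
gen-cons (F-bag d e)      = genᵇ-base (cons d e)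
gen-cons (F-convᵇ e c d)  = genᵇ-conv e c (gen-cons d)

mutual
  ⊨⇒dom≡mfv : Γ ⊨ M ∶ τ → dom Γ ≡ mfv M
  ⊨⇒dom≡mfv {M = var x} d with gen-var d
  ... | conv (var {σ = σ}) e _ = dom-≈ (x ∷ []) e (dom-single x σ)
  ⊨⇒dom≡mfv {M = lam M} d with gen-lam d
  ... | conv (abs body) e _ = dom-≈ (mfv (lam M)) e (dom-tail (mfv M) (⊨⇒dom≡mfv body))
  ⊨⇒dom≡mfv {M = M · B} d with gen-app d
  ... | conv (app {Γ = Γ₁} {Δ = Δ₁} dM dB) e _ =
    dom-≈ (mfv (M · B)) e (dom-∧ Γ₁ Δ₁ (mfv M) (mfvB B) (⊨⇒dom≡mfv dM) (⊨ᵇ⇒dom≡mfvB dB))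
  ⊨⇒dom≡mfv {M = M ⟨ B ⟩} d with gen-ex d
  ... | conv (ex {Γ = Γ₁} {Δ = Δ₁} dM dB) e _ =
    dom-≈ (mfv (M ⟨ B ⟩)) e
      (dom-∧ Γ₁ Δ₁ (dropZero (mfv M)) (mfvB B) (dom-tail (mfv M) (⊨⇒dom≡mfv dM)) (⊨ᵇ⇒dom≡mfvB dB))
  ⊨⇒dom≡mfv {M = fail xs} d = gen-fail d

  ⊨ᵇ⇒dom≡mfvB : Δ ⊨ᵇ B ∶ π → dom Δ ≡ mfvB B
  ⊨ᵇ⇒dom≡mfvB {B = []} d with gen-nil d
  ... | conv nil e _ = dom-≈ [] e dom-∅
  ⊨ᵇ⇒dom≡mfvB {B = M ∷ B} d with gen-cons d
  ... | conv (cons {Γ = Γ₁} {Δ = Δ₁} dM dB) e _ =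
    dom-≈ (mfvB (M ∷ B)) e (dom-∧ Γ₁ Δ₁ (mfv M) (mfvB B) (⊨⇒dom≡mfv dM) (⊨ᵇ⇒dom≡mfvB dB))

insertω : Ctx n → Fin (suc n) → Ctx (suc n)
insertω Γ p = insertAt Γ p []

insertω-cong : ∀ p → Γ ≈ Γ' → insertω Γ p ≈ insertω Γ' p
insertω-cong zero    Γ≈Γ'       = ≃ₘ-refl ∷ Γ≈Γ'
insertω-cong (suc p) (e ∷ Γ≈Γ') = e ∷ insertω-cong p Γ≈Γ'

insertω-∧ : ∀ (Γ Δ : Ctx n) p → insertω (Γ ∧ Δ) p ≡ insertω Γ p ∧ insertω Δ p
insertω-∧ Γ          Δ          zero    = refl
insertω-∧ (π ∷ᵥ Γ) (π' ∷ᵥ Δ) (suc p) = cong ((π ++ π') ∷ᵥ_) (insertω-∧ Γ Δ p)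

insertω-∧-≈ : ∀ (Γ Δ : Ctx n) p → (Γ ∧ Δ) ≈ Θ → (insertω Γ p ∧ insertω Δ p) ≈ insertω Θ p
insertω-∧-≈ Γ Δ p e = ≈-trans (≈-reflexive (sym (insertω-∧ Γ Δ p))) (insertω-cong p e)

insertω-∅ : ∀ p → insertω (∅ {n}) p ≡ ∅
insertω-∅ zero    = refl
insertω-∅ {suc n} (suc p) = cong ([] ∷ᵥ_) (insertω-∅ p)

insertω-single : ∀ (x : Fin n) σ p → insertω [ x ∶ σ ] p ≡ [ punchIn p x ∶ σ ]
insertω-single x       σ zero    = refl
insertω-single zero    σ (suc p) = cong ((σ ∷ []) ∷ᵥ_) (insertω-∅ p)
insertω-single (suc x) σ (suc p) = cong ([] ∷ᵥ_) (insertω-single x σ p)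

dom-insertω : ∀ (Γ : Ctx n) xs p → dom Γ ≡ xs → dom (insertω Γ p) ≡ mapFin (punchIn p) xs
dom-insertω Γ xs p dom-Γ j with p ≟ j
... | yes refl =
  trans (cong length (insertAt-lookup Γ p [])) (sym (occ-mapFin-∉ (punchIn p) (punchInᵢ≢i p) xs))
... | no p≢j =
  subst (λ j → length (lookup (insertω Γ p) j) ≡ occ j (mapFin (punchIn p) xs))
        (punchIn-punchOut p≢j) (at-punchIn (punchOut p≢j))
  where
  at-punchIn : ∀ i → length (lookup (insertω Γ p) (punchIn p i))
                    ≡ occ (punchIn p i) (mapFin (punchIn p) xs)
  at-punchIn i = trans (cong length (insertAt-punchIn Γ p [] i))
    (trans (dom-Γ i) (sym (occ-mapFin-injective (punchIn-injective p _ _) i xs)))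

ext-punchIn : ∀ {ρ : Fin n → Fin (suc n)} p → ρ ≗ punchIn p → ext ρ ≗ punchIn (suc p)
ext-punchIn p ρ≗ zero    = refl
ext-punchIn p ρ≗ (suc i) = cong suc (ρ≗ i)

mutual
  ⊨-rename : ∀ {ρ} p → ρ ≗ punchIn p → Γ ⊨ M ∶ τ → insertω Γ p ⊨ rename ρ M ∶ τ
  ⊨-rename {Γ = Γ} {M = var x} {ρ = ρ} p ρ≗ d with gen-var d
  ... | conv (var {σ = σ}) e c = F-conv ctx c (F-wf-expr T-var)
    where
    ctx : [ ρ x ∶ σ ] ≈ insertω Γ p
    ctx = ≈-trans (≈-reflexive (trans (cong [_∶ σ ] (ρ≗ x)) (sym (insertω-single x σ p))))
                  (insertω-cong p e)
  ⊨-rename {M = lam M} p ρ≗ d with gen-lam d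
  ... | conv (abs body) e c =
    F-conv (insertω-cong p e) c (F-abs (⊨-rename (suc p) (ext-punchIn p ρ≗) body))
  ⊨-rename {M = M · B} p ρ≗ d with gen-app d
  ... | conv (app {Γ = Γ₁} {Δ = Δ₁} dM dB) e c =
    F-conv (insertω-∧-≈ Γ₁ Δ₁ p e) c (F-app (⊨-rename p ρ≗ dM) (⊨ᵇ-rename p ρ≗ dB))
  ⊨-rename {M = M ⟨ B ⟩} p ρ≗ d with gen-ex d
  ... | conv (ex {Γ = Γ₁} {Δ = Δ₁} dM dB) e c =
    F-conv (insertω-∧-≈ Γ₁ Δ₁ p e) c
      (F-ex-sub (⊨-rename (suc p) (ext-punchIn p ρ≗) dM) (⊨ᵇ-rename p ρ≗ dB))
  ⊨-rename {Γ = Γ} {M = fail xs} {ρ = ρ} p ρ≗ d =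
    F-fail (subst (dom (insertω Γ p) ≡_) (sym (mapFin-cong ρ≗ xs))
                  (dom-insertω Γ xs p (gen-fail d)))

  ⊨ᵇ-rename : ∀ {ρ} p → ρ ≗ punchIn p → Δ ⊨ᵇ B ∶ π → insertω Δ p ⊨ᵇ renameB ρ B ∶ π
  ⊨ᵇ-rename {B = []} p ρ≗ d with gen-nil d
  ... | conv nil e c =
    F-convᵇ (≈-trans (≈-reflexive (sym (insertω-∅ p))) (insertω-cong p e)) c (F-wf-bag T-one)
  ⊨ᵇ-rename {B = M ∷ B} p ρ≗ d with gen-cons d
  ... | conv (cons {Γ = Γ₁} {Δ = Δ₁} dM dB) e c =
    F-convᵇ (insertω-∧-≈ Γ₁ Δ₁ p e) c (F-bag (⊨-rename p ρ≗ dM) (⊨ᵇ-rename p ρ≗ dB))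

⊨-weaken : Γ ⊨ N ∶ σ → [] ∷ᵥ Γ ⊨ weaken N ∶ σ
⊨-weaken = ⊨-rename zero (λ _ → refl)

data HeadHole (Γ : Ctx n) (M : Term n) (x : Fin n) (τ : SType) : Set where
  hole : ∀ {σ Γ₀} → Γ ≈ (Γ₀ ∧ [ x ∶ σ ]) →
         (∀ {Δ N} → Δ ⊨ N ∶ σ → Γ₀ ∧ Δ ⊨ headSubst M x N ∶ τ) → HeadHole Γ M x τ

headSubst-var : ∀ (x : Fin n) N → headSubst (var x) x N ≡ N
headSubst-var x N with x ≟ x
... | yes _  = refl
... | no x≢x = ⊥-elim (x≢x refl)

headVar-⟨⟩ : ∀ (M : Term (suc n)) B → headVar (M ⟨ B ⟩) ≡ just x → headVar M ≡ just (suc x)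
headVar-⟨⟩ M B eq with headVar M
headVar-⟨⟩ M B refl | just (suc i) = refl

⊨-headHole : Γ ⊨ M ∶ τ → headVar M ≡ just x → HeadHole Γ M x τ
⊨-headHole {M = var y} d refl with gen-var d
... | conv var e c = hole (≈-trans (≈-sym e) (≈-sym (∧-identityˡ _))) λ {Δ} {N} dN →
  subst (∅ ∧ Δ ⊨_∶ _) (sym (headSubst-var y N)) (F-conv (≈-sym (∧-identityˡ Δ)) c dN)
⊨-headHole {M = M · B} d hv with gen-app d
... | conv (app {Δ = Δ₁} dM dB) e c with ⊨-headHole dM hv
... | hole {Γ₀ = Γ₀} e₁ f =
  hole (≈-trans (≈-sym e) (≈-trans (∧-cong e₁ ≈-refl) (∧-swapʳ Γ₀ _ Δ₁))) λ {Δ} dN →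
    F-conv (∧-swapʳ Γ₀ Δ Δ₁) c (F-app (f dN) dB)
⊨-headHole {M = M ⟨ B ⟩} d hv with gen-ex d
... | conv (ex {Δ = Δ₁} dM dB) e c with ⊨-headHole dM (headVar-⟨⟩ M B hv)
... | hole {Γ₀ = π ∷ᵥ Γ₀} (eh ∷ e₁) f =
  hole (≈-trans (≈-sym e) (≈-trans (∧-cong e₁ ≈-refl) (∧-swapʳ Γ₀ _ Δ₁))) λ {Δ} dN →
    F-conv (∧-swapʳ Γ₀ Δ Δ₁) c
      (F-ex-sub (F-conv (≃ₘ-sym eh ∷ ≈-refl) ≃-refl (f (⊨-weaken dN))) dB)

data _⊨ᵁ_∶_ {n : ℕ} : Ctx n → Bag n → SType → Set where
  nil  : Δ ≈ ∅ → Δ ⊨ᵁ [] ∶ σ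
  cons : Γ ⊨ M ∶ σ → Δ ⊨ᵁ B ∶ σ → (Γ ∧ Δ) ≈ Θ → Θ ⊨ᵁ M ∷ B ∶ σ

⊨ᵇ⇒⊨ᵁ : Δ ⊨ᵇ B ∶ π → All (_≃ σ) π → Δ ⊨ᵁ B ∶ σ
⊨ᵇ⇒⊨ᵁ {B = []} d _ with gen-nil d
... | conv nil e _ = nil (≈-sym e)
⊨ᵇ⇒⊨ᵁ {B = M ∷ B} d uniform with gen-cons d
... | conv (cons {k = k} dM dB) e c with uniform-≃ₘ uniform c
... | σ₁≃σ ∷ _ = cons (F-conv ≈-refl σ₁≃σ dM) (⊨ᵇ⇒⊨ᵁ dB (All.replicate⁺ k σ₁≃σ)) e

⊨ᵁ⇒⊨ᵇ : Δ ⊨ᵁ B ∶ σ → Δ ⊨ᵇ B ∶ σ ^ length B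
⊨ᵁ⇒⊨ᵇ (nil e)       = F-convᵇ (≈-sym e) ≃ₘ-refl (F-wf-bag T-one)
⊨ᵁ⇒⊨ᵇ (cons dM dB e) = F-convᵇ e ≃ₘ-refl (F-bag dM (⊨ᵁ⇒⊨ᵇ dB))

⊨ᵁ-↭ : B ↭ R → Δ ⊨ᵁ B ∶ σ → Δ ⊨ᵁ R ∶ σ
⊨ᵁ-↭ ↭.refl         d              = d
⊨ᵁ-↭ (↭.prep _ p)   (cons dM dB e) = cons dM (⊨ᵁ-↭ p dB) e
⊨ᵁ-↭ (↭.swap _ _ p) (cons {Γ = Γ₁} dM (cons {Γ = Γ₂} {Δ = Δ₂} dN dB e₂) e₁) =
  cons dN (cons dM (⊨ᵁ-↭ p dB) ≈-refl)
       (≈-trans (∧-swapˡ Γ₂ Γ₁ Δ₂) (≈-trans (∧-cong ≈-refl e₂) e₁))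
⊨ᵁ-↭ (↭.trans p q)  d              = ⊨ᵁ-↭ q (⊨ᵁ-↭ p d)

picks-↭ : ∀ (xs : List A) → All (λ p → xs ↭ proj₁ p ∷ proj₂ p) (picks xs)
picks-↭ []       = []
picks-↭ (x ∷ xs) =
  ↭.refl ∷ All.map⁺ (All.map (λ p → ↭.trans (↭.prep x p) (↭.swap x _ ↭.refl)) (picks-↭ xs))

⊨-fetch : {M : Term (suc n)} → Γ ⊨ M ⟨ B ⟩ ∶ τ → headVar M ≡ just zero → B ↭ N ∷ R →
          Γ ⊨ headSubst M zero (weaken N) ⟨ R ⟩ ∶ τ
⊨-fetch {Γ = Γ} d hv B↭N∷R with gen-ex d
... | conv (ex {σ = σ₁} {j = j} {Γ = Γ₁} {Δ = Δ₁} dM dB) ctx ty with ⊨-headHole dM hv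
... | hole {σ = σ} {Γ₀ = π ∷ᵥ Γ₀} (eh ∷ e₀) f with ⊨ᵁ-↭ B↭N∷R (⊨ᵇ⇒⊨ᵁ dB (^-uniform _))
... | cons {Γ = Γ₂} {Δ = Δ₂} dN dR e =
  F-conv ctx′ ty
    (F-ex-sub (F-conv (π≃ ∷ ≈-refl) ≃-refl (f (⊨-weaken (F-conv ≈-refl σ₁≃σ dN)))) (⊨ᵁ⇒⊨ᵇ dR))
  where
  uniform : All (_≃ σ₁) (π ++ σ ∷ [])
  uniform = uniform-≃ₘ (^-uniform j) (≃ₘ-sym eh)

  π≃ : (π ++ []) ≃ₘ (σ₁ ^ length π)
  π≃ = ≃ₘ-trans (≃ₘ-reflexive (List.++-identityʳ π)) (uniform⇒≃ₘ^ (All.++⁻ˡ π uniform))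

  σ₁≃σ : σ₁ ≃ σ
  σ₁≃σ with All.++⁻ʳ π uniform
  ... | σ≃σ₁ ∷ [] = ≃-sym σ≃σ₁

  open import Relation.Binary.Reasoning.Setoid (≈-setoid _)

  ctx′ : ((Γ₀ ∧ Γ₂) ∧ Δ₂) ≈ Γ
  ctx′ = begin
    (Γ₀ ∧ Γ₂) ∧ Δ₂  ≈⟨ ∧-assoc Γ₀ Γ₂ Δ₂ ⟩
    Γ₀ ∧ (Γ₂ ∧ Δ₂)  ≈⟨ ∧-cong ≈-refl e ⟩
    Γ₀ ∧ Δ₁         ≈⟨ ∧-cong (≈-sym (≈-trans e₀ (∧-identityʳ Γ₀))) ≈-refl ⟩
    Γ₁ ∧ Δ₁         ≈⟨ ctx ⟩
    Γ               ∎

sumPER-⊨ : ∀ B {t} → Γ ⊨ t ∶ τ → All (Γ ⊨_∶ τ) (toList (sumPER B t))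
sumPER-⊨ B d = d ∷ All.replicate⁺ _ d

⟶ₜ-preserves-⊨ : ∀ {𝕄} → Γ ⊨ M ∶ τ → M ⟶ₜ 𝕄 → All (Γ ⊨_∶ τ) (toList 𝕄)
⟶ₜ-preserves-⊨ d R-Beta with gen-app d
... | conv (app dL dB) e c with gen-lam dL
... | conv (abs body) e′ (arr p q r) =
  F-conv e c (F-ex-sub (F-conv ((_ , p , q) ∷ e′) r body) dB) ∷ []
⟶ₜ-preserves-⊨ d (R-Fetch {N = N} {B = B} hv _) =
  All.map⁺ (All.map (⊨-fetch d hv) (picks-↭ (N ∷ B)))
-- A failure reduct collects exactly the free variables of its redex.
⟶ₜ-preserves-⊨ d (R-Fail {B = B} _)  = sumPER-⊨ B (F-fail (⊨⇒dom≡mfv d))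
⟶ₜ-preserves-⊨ d (R-Cons₁ {B = B})   = sumPER-⊨ B (F-fail (⊨⇒dom≡mfv d))
⟶ₜ-preserves-⊨ d (R-Cons₂ {B = B} _) = sumPER-⊨ B (F-fail (⊨⇒dom≡mfv d))
⟶ₜ-preserves-⊨ d (R-TCont-app {𝕄 = _ ∷ _} r) with gen-app d
... | conv (app dM dB) e c =
  All.map⁺ (All.map (λ dM′ → F-conv e c (F-app dM′ dB)) (⟶ₜ-preserves-⊨ dM r))
⟶ₜ-preserves-⊨ d (R-TCont-es {𝕄 = _ ∷ _} r) with gen-ex d
... | conv (ex dM dB) e c =
  All.map⁺ (All.map (λ dM′ → F-conv e c (F-ex-sub dM′ dB)) (⟶ₜ-preserves-⊨ dM r))

⟶-preserves-⊨ : ∀ {𝕄 𝕄'} → All (Γ ⊨_∶ τ) (toList 𝕄) → 𝕄 ⟶ 𝕄' → All (Γ ⊨_∶ τ) (toList 𝕄')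
⟶-preserves-⊨ (d ∷ ds) (R-here {𝕄 = _ ∷ _} r)   = All.++⁺ (⟶ₜ-preserves-⊨ d r) ds
⟶-preserves-⊨ (d ∷ ds) (R-there {𝕄' = _ ∷ _} r) = d ∷ ⟶-preserves-⊨ ds r

theorem2p25 : ∀ {n} {Γ : Ctx n} {σ : SType} {𝕄 𝕄' : Expr n} →
    Γ ⊨ₑ 𝕄 ∶ σ → 𝕄 ⟶ 𝕄' → Γ ⊨ₑ 𝕄' ∶ σ
theorem2p25 {𝕄 = _ ∷ _} {𝕄' = _ ∷ _} (d , ds) r with ⟶-preserves-⊨ (d ∷ ds) r
... | d′ ∷ ds′ = d′ , ds′
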